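{- Let ${\mathcal X}$ be a family of subsets of a finite set $E$ and ${\mathcal M}$ be a loopless ${\mathcal X}$-matroid on $E$. Suppose that for every connected flat $F$ of ${\mathcal M}$ there is a proper ${\mathcal X}$-sequence ${\mathcal S}$ with $r_{\mathcal M}(F)={\rm val}(F,{\mathcal S})$. Then ${\rm val}_{{\mathcal X}}=r_{{\mathcal M}}$ and ${\mathcal M}$ is the unique maximal ${\mathcal X}$-matroid on $E$ (with respect to the weak order).
   Context: An ${\mathcal X}$-matroid on $E$ is a matroid on $E$ in which every set in ${\mathcal X}$ is a circuit. A proper ${\mathcal X}$-sequence is a sequence ${\mathcal S}=(X_1,\dots,X_k)$ of sets in ${\mathcal X}$ with $X_i\not\subseteq \bigcup_{j<i}X_j$ for $i\ge 2$; ${\rm val}(F,{\mathcal S})=|F\cup \bigcup_{i=1}^k X_i|-k$, and ${\rm val}_{{\mathcal X}}(F)=\min_{{\mathcal S}}{\rm val}(F,{\mathcal S})$ over all proper ${\mathcal X}$-sequences. A set $F$ is connected in ${\mathcal M}$ if every two elements of $F$ lie in a common circuit contained in $F$; a flat is a set equal to its closure. Weak order: ${\mathcal M}_1\preceq{\mathcal M}_2$ if every independent set of ${\mathcal M}_1$ is independent in ${\mathcal M}_2$. -}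

module Defs where

open import Data.Nat using (ℕ; _≤_; _<_)
open import Data.Integer as ℤ using (ℤ; +_; _-_)
open import Data.Fin using (Fin)
open import Data.Fin.Subset using (Subset; _∈_; _∉_; _⊆_; _⊂_; _∪_; ⁅_⁆; ∣_∣; ⊥)
open import Data.List using (List; []; _∷_; length; foldr)
open import Data.List.Relation.Unary.All using (All)
open import Data.Product using (Σ; ∃; ∃-syntax; _×_; _,_)
open import Data.Unit using (⊤)
open import Relation.Nullary using (¬_; Dec)
open import Relation.Binary.PropositionalEquality using (_≡_)

-- The ground set E is Fin n; subsets of E are Data.Fin.Subset.Subset n.

-- A matroid on Fin n, given by its independent sets (standard axioms).
-- Independence is required to be decidable (classically automatic for a
-- finite ground set; needed constructively).
record Matroid (n : ℕ) : Set₁ where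
  field
    Indep      : Subset n → Set
    indep?     : (I : Subset n) → Dec (Indep I)
    indep-∅    : Indep ⊥
    indep-⊆    : ∀ {I J} → J ⊆ I → Indep I → Indep J
    augment    : ∀ {I J} → Indep I → Indep J → ∣ I ∣ < ∣ J ∣ →
                 ∃[ e ] (e ∈ J × e ∉ I × Indep (I ∪ ⁅ e ⁆))

open Matroid public

module _ {n : ℕ} (M : Matroid n) where

  Dependent : Subset n → Set
  Dependent X = ¬ Indep M X

  IsCircuit : Subset n → Set
  IsCircuit C = Dependent C × (∀ D → D ⊂ C → Indep M D)

  Loopless : Set
  Loopless = ∀ e → Indep M ⁅ e ⁆

  IsRank : Subset n → ℕ → Set
  IsRank F k = (∃[ I ] (I ⊆ F × Indep M I × ∣ I ∣ ≡ k))
             × (∀ I → I ⊆ F → Indep M I → ∣ I ∣ ≤ k)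

  -- e ∈ cl(F) iff r(F ∪ {e}) = r(F)
  InClosure : Subset n → Fin n → Set
  InClosure F e = ∀ k → IsRank F k → IsRank (F ∪ ⁅ e ⁆) k

  -- F is a flat: F = cl(F) (F ⊆ cl(F) always holds)
  IsFlat : Subset n → Set
  IsFlat F = ∀ e → InClosure F e → e ∈ F

  IsConnected : Subset n → Set
  IsConnected F = ∀ e f → e ∈ F → f ∈ F →
    ∃[ C ] (IsCircuit C × C ⊆ F × e ∈ C × f ∈ C)

Family : ℕ → Set₁
Family n = Subset n → Set

IsXMatroid : ∀ {n} → Family n → Matroid n → Set
IsXMatroid 𝒳 M = ∀ X → 𝒳 X → IsCircuit M X

_≼_ : ∀ {n} → Matroid n → Matroid n → Set
M₁ ≼ M₂ = ∀ I → Indep M₁ I → Indep M₂ I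

⋃ : ∀ {n} → List (Subset n) → Subset n
⋃ = foldr _∪_ ⊥

-- properness of the tail given the union U of the earlier sets
ProperFrom : ∀ {n} → Subset n → List (Subset n) → Set
ProperFrom U []       = ⊤
ProperFrom U (X ∷ Xs) = ¬ (X ⊆ U) × ProperFrom (U ∪ X) Xs

-- proper 𝒳-sequence (X₁,…,X_k): all Xᵢ ∈ 𝒳 and Xᵢ ⊈ ⋃_{j<i} Xⱼ for i ≥ 2
IsProperSeq : ∀ {n} → Family n → List (Subset n) → Set
IsProperSeq 𝒳 S = All 𝒳 S × P S
  where
  P : _ → Set
  P []       = ⊤
  P (X ∷ Xs) = ProperFrom X Xs

val : ∀ {n} → Subset n → List (Subset n) → ℤ
val F S = + ∣ F ∪ ⋃ S ∣ - + length S

IsValX : ∀ {n} → Family n → Subset n → ℤ → Set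
IsValX 𝒳 F v = (∃[ S ] (IsProperSeq 𝒳 S × val F S ≡ v))
             × (∀ S → IsProperSeq 𝒳 S → v ℤ.≤ val F S)

{-# OPTIONS --safe #-}
-- In any 𝒳-matroid, each member of a proper 𝒳-sequence is a circuit not contained in the union of
-- the earlier members, so it raises the nullity |A| - r(A) of the union by at least one; hence
-- val(F, S) ≥ r(F). Conversely, a flat of the loopless matroid M splits into a connected component,
-- which is a connected flat and so has a sequence of value r given by the hypothesis, and the rest,
-- which is a flat of smaller rank; the two ranks add up, so concatenating the sequences gives a
-- sequence of value r. Applied to the closure of F this yields val(F, S) = r(F). Finally, for an
-- independent set I of another 𝒳-matroid M′, the lower bound in M′ and the sequence of value r_M(I)
-- give |I| ≤ r_M(I), so I is independent in M.
module Submission where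

open import Defs
open import Data.Bool using (if_then_else_)
open import Data.Empty using (⊥-elim)
open import Data.Fin using (Fin; _≟_)
open import Data.Fin.Subset
  using (Subset; inside; outside; _∈_; _∉_; _⊆_; _⊈_; _⊂_; _⊃_; _∪_; _∩_; _─_; _-_; ⁅_⁆; ∣_∣; Nonempty)
  renaming (⊥ to ∅)
open import Data.Fin.Subset.Properties
open import Data.Fin.Subset.Induction using (⊂-wellFounded; ⊃-wellFounded)
open import Data.Fin.Properties using (any?)
import Data.Integer as ℤ
import Data.Integer.Properties as ℤ
open import Data.List using (List; []; _∷_; length; _++_)
open import Data.List.Properties using (length-++)
open import Data.List.Relation.Unary.All using (All; []; _∷_)
open import Data.List.Relation.Unary.All.Properties using (++⁺)
open import Data.Nat using (ℕ; suc; _+_; _∸_; _≤_; _<_; _≤?_; s≤s; z≤n)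
open import Data.Nat.Induction using (<-wellFounded)
open import Data.Nat.Properties
  using (≤-refl; ≤-trans; ≤-antisym; ≤-reflexive; <⇒≱; ≰⇒>; +-comm; +-suc; +-identityʳ;
         m+[n∸m]≡n; m+n∸m≡n; ∸-monoʳ-≤; +-∸-assoc; +-monoˡ-≤; +-monoʳ-≤;
         m+n≤o⇒n≤o; m+n≤o⇒m≤o∸n; m<n⇒0<n∸m; m∸n+n≡m; m+n∸n≡m; +-cancelʳ-≤; +-mono-≤; m≤m+n;
         +-commutativeSemigroup; module ≤-Reasoning)
open import Data.Product using (∃; ∃-syntax; _×_; _,_; proj₁; proj₂)
open import Data.Sum using (_⊎_; inj₁; inj₂; [_,_])
open import Data.Vec using ([]; _∷_; tabulate; here; there)
open import Data.Vec.Properties using (lookup∘tabulate; []=⇒lookup; lookup⇒[]=)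
open import Function using (id; _∘_)
open import Algebra.Properties.CommutativeSemigroup +-commutativeSemigroup using (interchange)
open import Induction.WellFounded using (Acc; acc)
open import Relation.Nullary using (¬_; Dec; yes; no; does)
open import Relation.Nullary.Decidable using (¬?; _×-dec_)
open import Relation.Unary using (Pred; Decidable)
open import Relation.Binary.PropositionalEquality using (_≡_; _≢_; refl; sym; trans; cong; subst; module ≡-Reasoning)

module _ {n : ℕ} where

  subsetOf : ∀ {ℓ} {P : Pred (Fin n) ℓ} → Decidable P → Subset n
  subsetOf P? = tabulate (λ x → if does (P? x) then inside else outside)

  ∈-subsetOf⁺ : ∀ {ℓ} {P : Pred (Fin n) ℓ} (P? : Decidable P) {x} → P x → x ∈ subsetOf P?
  ∈-subsetOf⁺ P? {x} px = lookup⇒[]= x _ (trans (lookup∘tabulate _ x) (decided (P? x)))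
    where
    decided : (d : Dec _) → (if does d then inside else outside) ≡ inside
    decided (yes _)  = refl
    decided (no ¬px) = ⊥-elim (¬px px)

  ∈-subsetOf⁻ : ∀ {ℓ} {P : Pred (Fin n) ℓ} (P? : Decidable P) {x} → x ∈ subsetOf P? → P x
  ∈-subsetOf⁻ P? {x} x∈ = decided (P? x) (trans (sym (lookup∘tabulate _ x)) ([]=⇒lookup x∈))
    where
    decided : (d : Dec _) → (if does d then inside else outside) ≡ inside → _
    decided (yes px) _ = px
    decided (no _)   ()

x∈p─q⇒x∉q : ∀ {n} {p q : Subset n} {x} → x ∈ p ─ q → x ∉ q
x∈p─q⇒x∉q {p = _ ∷ _} {outside ∷ _} here       ()
x∈p─q⇒x∉q {p = _ ∷ _} {_ ∷ _}       (there x∈) (there x∈q) = x∈p─q⇒x∉q x∈ x∈q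

∣p∪q∣+∣p∩q∣≡∣p∣+∣q∣ : ∀ {n} (p q : Subset n) → ∣ p ∪ q ∣ + ∣ p ∩ q ∣ ≡ ∣ p ∣ + ∣ q ∣
∣p∪q∣+∣p∩q∣≡∣p∣+∣q∣ [] [] = refl
∣p∪q∣+∣p∩q∣≡∣p∣+∣q∣ (outside ∷ p) (outside ∷ q) = ∣p∪q∣+∣p∩q∣≡∣p∣+∣q∣ p q
∣p∪q∣+∣p∩q∣≡∣p∣+∣q∣ (outside ∷ p) (inside ∷ q) =
  trans (cong suc (∣p∪q∣+∣p∩q∣≡∣p∣+∣q∣ p q)) (sym (+-suc ∣ p ∣ ∣ q ∣))
∣p∪q∣+∣p∩q∣≡∣p∣+∣q∣ (inside ∷ p) (outside ∷ q) = cong suc (∣p∪q∣+∣p∩q∣≡∣p∣+∣q∣ p q)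
∣p∪q∣+∣p∩q∣≡∣p∣+∣q∣ (inside ∷ p) (inside ∷ q) = cong suc (begin
  ∣ p ∪ q ∣ + suc ∣ p ∩ q ∣ ≡⟨ +-suc ∣ p ∪ q ∣ ∣ p ∩ q ∣ ⟩
  suc (∣ p ∪ q ∣ + ∣ p ∩ q ∣) ≡⟨ cong suc (∣p∪q∣+∣p∩q∣≡∣p∣+∣q∣ p q) ⟩
  suc (∣ p ∣ + ∣ q ∣)         ≡⟨ +-suc ∣ p ∣ ∣ q ∣ ⟨
  ∣ p ∣ + suc ∣ q ∣           ∎)
  where open ≡-Reasoning

module _ {n : ℕ} where

  Disjoint : Subset n → Subset n → Set
  Disjoint p q = ∀ {x} → x ∈ p → x ∉ q

  ∣p∪q∣≡∣p∣+∣q∣ : ∀ {p q : Subset n} → Disjoint p q → ∣ p ∪ q ∣ ≡ ∣ p ∣ + ∣ q ∣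
  ∣p∪q∣≡∣p∣+∣q∣ {p} {q} p#q = begin
    ∣ p ∪ q ∣             ≡⟨ +-identityʳ _ ⟨
    ∣ p ∪ q ∣ + 0         ≡⟨ cong (∣ p ∪ q ∣ +_) (∣⊥∣≡0 n) ⟨
    ∣ p ∪ q ∣ + ∣ ∅ {n} ∣ ≡⟨ cong (λ s → ∣ p ∪ q ∣ + ∣ s ∣) p∩q≡∅ ⟨
    ∣ p ∪ q ∣ + ∣ p ∩ q ∣ ≡⟨ ∣p∪q∣+∣p∩q∣≡∣p∣+∣q∣ p q ⟩
    ∣ p ∣ + ∣ q ∣         ∎
    where
    open ≡-Reasoning
    p∩q≡∅ : p ∩ q ≡ ∅
    p∩q≡∅ = Empty-unique λ (x , x∈p∩q) → let x∈p , x∈q = x∈p∩q⁻ p q x∈p∩q in p#q x∈p x∈q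

  ∣p∪⁅x⁆∣≡1+∣p∣ : ∀ {p : Subset n} {x} → x ∉ p → ∣ p ∪ ⁅ x ⁆ ∣ ≡ suc ∣ p ∣
  ∣p∪⁅x⁆∣≡1+∣p∣ {p} {x} x∉p = begin
    ∣ p ∪ ⁅ x ⁆ ∣   ≡⟨ ∣p∪q∣≡∣p∣+∣q∣ (λ y∈p y∈⁅x⁆ → x∉p (subst (_∈ p) (x∈⁅y⁆⇒x≡y x y∈⁅x⁆) y∈p)) ⟩
    ∣ p ∣ + ∣ ⁅ x ⁆ ∣ ≡⟨ cong (∣ p ∣ +_) (∣⁅x⁆∣≡1 x) ⟩
    ∣ p ∣ + 1        ≡⟨ +-comm ∣ p ∣ 1 ⟩
    suc ∣ p ∣        ∎
    where open ≡-Reasoning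

  ∈-∪⁅⁆⁻ : ∀ {p : Subset n} {x y} → x ∈ p ∪ ⁅ y ⁆ → x ∈ p ⊎ x ≡ y
  ∈-∪⁅⁆⁻ {p} {y = y} x∈ with x∈p∪q⁻ p ⁅ y ⁆ x∈
  ... | inj₁ x∈p  = inj₁ x∈p
  ... | inj₂ x∈⁅y⁆ = inj₂ (x∈⁅y⁆⇒x≡y y x∈⁅y⁆)

  x∈p-y⇒x≢y : ∀ {p : Subset n} {x y} → x ∈ p - y → x ≢ y
  x∈p-y⇒x≢y x∈ = x∉⁅y⁆⇒x≢y (x∈p─q⇒x∉q x∈)

  p⊈q⇒∃x∈p∉q : ∀ {p q : Subset n} → p ⊈ q → ∃ λ x → x ∈ p × x ∉ q
  p⊈q⇒∃x∈p∉q {p} {q} p⊈q with nonempty? (p ─ q)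
  ... | yes (x , x∈p─q) = x , p─q⊆p p q x∈p─q , x∈p─q⇒x∉q x∈p─q
  ... | no p─q-empty = ⊥-elim (p⊈q p⊆q)
    where
    p⊆q : p ⊆ q
    p⊆q {x} x∈p with x ∈? q
    ... | yes x∈q = x∈q
    ... | no x∉q  = ⊥-elim (p─q-empty (x , x∈p∧x∉q⇒x∈p─q x∈p x∉q))

  p⊆q∧∣q∣≤∣p∣⇒q⊆p : ∀ {p q : Subset n} → p ⊆ q → ∣ q ∣ ≤ ∣ p ∣ → q ⊆ p
  p⊆q∧∣q∣≤∣p∣⇒q⊆p {p} {q} p⊆q ∣q∣≤∣p∣ with q ⊆? p
  ... | yes q⊆p = q⊆p
  ... | no q⊈p  = let x , x∈q , x∉p = p⊈q⇒∃x∈p∉q q⊈p in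
    ⊥-elim (<⇒≱ (p⊂q⇒∣p∣<∣q∣ (p⊆q , x , x∈q , x∉p)) ∣q∣≤∣p∣)

  x∈p∪q∧x∉p⇒x∈q : ∀ {p q : Subset n} {x} → x ∈ p ∪ q → x ∉ p → x ∈ q
  x∈p∪q∧x∉p⇒x∈q {p} {q} x∈p∪q x∉p with x∈p∪q⁻ p q x∈p∪q
  ... | inj₁ x∈p = ⊥-elim (x∉p x∈p)
  ... | inj₂ x∈q = x∈q

  x∈p∪q∧x∉q⇒x∈p : ∀ {p q : Subset n} {x} → x ∈ p ∪ q → x ∉ q → x ∈ p
  x∈p∪q∧x∉q⇒x∈p {p} {q} x∈p∪q x∉q = x∈p∪q∧x∉p⇒x∈q (subst (_ ∈_) (∪-comm p q) x∈p∪q) x∉q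

  ∪-lub : ∀ {p q r : Subset n} → p ⊆ r → q ⊆ r → p ∪ q ⊆ r
  ∪-lub {p} {q} p⊆r q⊆r x∈ = [ p⊆r , q⊆r ] (x∈p∪q⁻ p q x∈)

  ∪-monoˡ-⊆ : ∀ {p q : Subset n} r → p ⊆ q → p ∪ r ⊆ q ∪ r
  ∪-monoˡ-⊆ {q = q} r p⊆q = ∪-lub (p⊆p∪q r ∘ p⊆q) (q⊆p∪q q r)

  x∈p⇒⁅x⁆⊆p : ∀ {p : Subset n} {x} → x ∈ p → ⁅ x ⁆ ⊆ p
  x∈p⇒⁅x⁆⊆p {x = x} x∈p y∈⁅x⁆ = subst (_∈ _) (sym (x∈⁅y⁆⇒x≡y x y∈⁅x⁆)) x∈p

  x∈p⇒p∪⁅x⁆⊆p : ∀ {p : Subset n} {x} → x ∈ p → p ∪ ⁅ x ⁆ ⊆ p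
  x∈p⇒p∪⁅x⁆⊆p x∈p = ∪-lub id (x∈p⇒⁅x⁆⊆p x∈p)

  p⊆q∪⁅x⁆⇒p-x⊆q : ∀ {p q : Subset n} {x} → p ⊆ q ∪ ⁅ x ⁆ → p - x ⊆ q
  p⊆q∪⁅x⁆⇒p-x⊆q {p} {x = x} p⊆q+x y∈p-x with ∈-∪⁅⁆⁻ (p⊆q+x (p─q⊆p p ⁅ x ⁆ y∈p-x))
  ... | inj₁ y∈q = y∈q
  ... | inj₂ refl = ⊥-elim (x∈p-y⇒x≢y y∈p-x refl)

  ∣q∣+∣p─q∣≡∣p∣ : ∀ {p q : Subset n} → q ⊆ p → ∣ q ∣ + ∣ p ─ q ∣ ≡ ∣ p ∣
  ∣q∣+∣p─q∣≡∣p∣ {p} {q} q⊆p = begin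
    ∣ q ∣ + ∣ p ─ q ∣   ≡⟨ ∣p∪q∣≡∣p∣+∣q∣ {q} {p ─ q} (λ x∈q x∈p─q → x∈p─q⇒x∉q x∈p─q x∈q) ⟨
    ∣ q ∪ (p ─ q) ∣     ≡⟨ cong ∣_∣ (⊆-antisym q∪[p─q]⊆p p⊆q∪[p─q]) ⟩
    ∣ p ∣               ∎
    where
    open ≡-Reasoning
    q∪[p─q]⊆p : q ∪ (p ─ q) ⊆ p
    q∪[p─q]⊆p = ∪-lub q⊆p (p─q⊆p p q)
    p⊆q∪[p─q] : p ⊆ q ∪ (p ─ q)
    p⊆q∪[p─q] {x} x∈p with x ∈? q
    ... | yes x∈q = p⊆p∪q (p ─ q) x∈q
    ... | no x∉q  = q⊆p∪q q (p ─ q) (x∈p∧x∉q⇒x∈p─q x∈p x∉q)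

module Rank {n : ℕ} (M : Matroid n) where

  IsBasis : Subset n → Subset n → Set
  IsBasis A J = J ⊆ A × Indep M J × (∀ {e} → e ∈ A → e ∉ J → Dependent M (J ∪ ⁅ e ⁆))

  basis-maximum : ∀ {A J I} → IsBasis A J → I ⊆ A → Indep M I → ∣ I ∣ ≤ ∣ J ∣
  basis-maximum {J = J} {I} (_ , J-indep , J-maximal) I⊆A I-indep with ∣ I ∣ ≤? ∣ J ∣
  ... | yes ∣I∣≤∣J∣ = ∣I∣≤∣J∣
  ... | no ∣I∣≰∣J∣ =
    let e , e∈I , e∉J , J+e-indep = augment M J-indep I-indep (≰⇒> ∣I∣≰∣J∣) in
    ⊥-elim (J-maximal (I⊆A e∈I) e∉J J+e-indep)

  extend-to-basis : ∀ {A I} → Acc _⊃_ I → I ⊆ A → Indep M I → ∃ λ J → I ⊆ J × IsBasis A J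
  extend-to-basis {A} {I} (acc rs) I⊆A I-indep
    with any? (λ e → (e ∈? A) ×-dec ¬? (e ∈? I) ×-dec indep? M (I ∪ ⁅ e ⁆))
  ... | no none = I , id , I⊆A , I-indep , λ e∈A e∉I I+e-indep → none (_ , e∈A , e∉I , I+e-indep)
  ... | yes (e , e∈A , e∉I , I+e-indep) =
    let J , I+e⊆J , J-basis = extend-to-basis (rs I⊂I+e) I+e⊆A I+e-indep in
    J , I+e⊆J ∘ p⊆p∪q ⁅ e ⁆ , J-basis
    where
    I⊂I+e : I ⊂ I ∪ ⁅ e ⁆
    I⊂I+e = p⊆p∪q ⁅ e ⁆ , e , q⊆p∪q I ⁅ e ⁆ (x∈⁅x⁆ e) , e∉I
    I+e⊆A : I ∪ ⁅ e ⁆ ⊆ A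
    I+e⊆A = ∪-lub I⊆A (x∈p⇒⁅x⁆⊆p e∈A)

  -- Opaque, as otherwise the type checker unfolds the well-founded recursion behind r when comparing ranks.
  opaque
    basis : ∀ A → ∃ (IsBasis A)
    basis A = let J , _ , J-basis = extend-to-basis (⊃-wellFounded ∅) ⊥⊆ (indep-∅ M) in J , J-basis

  r : Subset n → ℕ
  r A = ∣ proj₁ (basis A) ∣

  ∣I∣≤r : ∀ {A I} → I ⊆ A → Indep M I → ∣ I ∣ ≤ r A
  ∣I∣≤r {A} = basis-maximum (proj₂ (basis A))

  r≤∣basis∣ : ∀ {A J} → IsBasis A J → r A ≤ ∣ J ∣
  r≤∣basis∣ {A} J-basis = let _ , B⊆A , B-indep , _ = basis A in basis-maximum J-basis B⊆A B-indep

  r≤∣∣ : ∀ A → r A ≤ ∣ A ∣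
  r≤∣∣ A = p⊆q⇒∣p∣≤∣q∣ (proj₁ (proj₂ (basis A)))

  r-mono : ∀ {A B} → A ⊆ B → r A ≤ r B
  r-mono {A} A⊆B = let _ , J⊆A , J-indep , _ = basis A in ∣I∣≤r (A⊆B ∘ J⊆A) J-indep

  IsRank-r : ∀ A → IsRank M A (r A)
  IsRank-r A = let J , J⊆A , J-indep , _ = basis A in (J , J⊆A , J-indep , refl) , λ _ → ∣I∣≤r

  IsRank⇒≡r : ∀ {A k} → IsRank M A k → k ≡ r A
  IsRank⇒≡r {A} ((I , I⊆A , I-indep , refl) , k-max) =
    let J , J⊆A , J-indep , _ = basis A in ≤-antisym (∣I∣≤r I⊆A I-indep) (k-max J J⊆A J-indep)

  ∣I∣≤r⇒indep : ∀ {I} → ∣ I ∣ ≤ r I → Indep M I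
  ∣I∣≤r⇒indep {I} ∣I∣≤rI =
    let J , J⊆I , J-indep , _ = basis I in indep-⊆ M (p⊆q∧∣q∣≤∣p∣⇒q⊆p J⊆I ∣I∣≤rI) J-indep

  Spans : Subset n → Fin n → Set
  Spans A e = r (A ∪ ⁅ e ⁆) ≤ r A

  basis-spans⇒dependent : ∀ {A J e} → IsBasis A J → Spans A e → e ∉ J → Dependent M (J ∪ ⁅ e ⁆)
  basis-spans⇒dependent {A} {J} {e} J-basis@(J⊆A , _) spans e∉J J+e-indep = <⇒≱ ∣J∣<∣J∣ ≤-refl
    where
    ∣J∣<∣J∣ : ∣ J ∣ < ∣ J ∣
    ∣J∣<∣J∣ = begin-strict
      ∣ J ∣             <⟨ ≤-reflexive (sym (∣p∪⁅x⁆∣≡1+∣p∣ e∉J)) ⟩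
      ∣ J ∪ ⁅ e ⁆ ∣     ≤⟨ ∣I∣≤r (∪-monoˡ-⊆ ⁅ e ⁆ J⊆A) J+e-indep ⟩
      r (A ∪ ⁅ e ⁆)     ≤⟨ spans ⟩
      r A               ≤⟨ r≤∣basis∣ J-basis ⟩
      ∣ J ∣             ∎
      where open ≤-Reasoning

module Circuits {n : ℕ} (M : Matroid n) where
  open Rank M

  private
    no-dependent-⊂⇒circuit : ∀ {D} → Dependent M D → ¬ (∃ λ D′ → D′ ⊂ D × Dependent M D′) → IsCircuit M D
    no-dependent-⊂⇒circuit D-dep none = D-dep , minimal
      where
      minimal : ∀ D′ → D′ ⊂ _ → Indep M D′
      minimal D′ D′⊂D with indep? M D′
      ... | yes D′-indep = D′-indep
      ... | no D′-dep    = ⊥-elim (none (D′ , D′⊂D , D′-dep))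

    dependent-⊂? : ∀ D → Dec (∃ λ D′ → D′ ⊂ D × Dependent M D′)
    dependent-⊂? D = anySubset? (λ D′ → (D′ ⊂? D) ×-dec ¬? (indep? M D′))

  isCircuit? : Decidable (IsCircuit M)
  isCircuit? D with indep? M D | dependent-⊂? D
  ... | yes D-indep | _                       = no λ (D-dep , _) → D-dep D-indep
  ... | no D-dep    | yes (D′ , D′⊂D , D′-dep) = no λ (_ , minimal) → D′-dep (minimal D′ D′⊂D)
  ... | no D-dep    | no none                 = yes (no-dependent-⊂⇒circuit D-dep none)

  circuit-⊆ : ∀ {D} → Dependent M D → ∃ λ C → IsCircuit M C × C ⊆ D
  circuit-⊆ {D} = go (⊂-wellFounded D)
    where
    go : ∀ {D} → Acc _⊂_ D → Dependent M D → ∃ λ C → IsCircuit M C × C ⊆ D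
    go {D} (acc rs) D-dep with dependent-⊂? D
    ... | no none = D , no-dependent-⊂⇒circuit D-dep none , id
    ... | yes (D′ , D′⊂D , D′-dep) =
      let C , C-circuit , C⊆D′ = go (rs D′⊂D) D′-dep in C , C-circuit , p⊂q⇒p⊆q D′⊂D ∘ C⊆D′

  circuit-nonempty : ∀ {C} → IsCircuit M C → Nonempty C
  circuit-nonempty {C} (C-dep , _) with nonempty? C
  ... | yes C-nonempty = C-nonempty
  ... | no C-empty     = ⊥-elim (C-dep (subst (Indep M) (sym (Empty-unique C-empty)) (indep-∅ M)))

  circuits-incomparable : ∀ {C D} → IsCircuit M C → IsCircuit M D → ¬ (D ⊂ C)
  circuits-incomparable (_ , C-minimal) (D-dep , _) D⊂C = D-dep (C-minimal _ D⊂C)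

  circuit-spans : ∀ {C B e} → IsCircuit M C → e ∈ C → C - e ⊆ B → Spans B e
  circuit-spans {C} {B} {e} (C-dep , C-minimal) e∈C C-e⊆B
    with extend-to-basis (⊃-wellFounded (C - e)) (p⊆p∪q ⁅ e ⁆ ∘ C-e⊆B) (C-minimal (C - e) (x∈p⇒p-x⊂p e∈C))
  ... | J , C-e⊆J , J-basis@(J⊆B+e , J-indep , _) with e ∈? J
  ...   | yes e∈J = ⊥-elim (C-dep (indep-⊆ M C⊆J J-indep))
    where
    C⊆J : C ⊆ J
    C⊆J {x} x∈C with x ≟ e
    ... | yes refl = e∈J
    ... | no x≢e   = C-e⊆J (x∈p∧x≢y⇒x∈p-y x∈C x≢e)
  ...   | no e∉J = ≤-trans (r≤∣basis∣ J-basis) (∣I∣≤r J⊆B J-indep)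
    where
    J⊆B : J ⊆ B
    J⊆B x∈J with ∈-∪⁅⁆⁻ (J⊆B+e x∈J)
    ... | inj₁ x∈B = x∈B
    ... | inj₂ refl = ⊥-elim (e∉J x∈J)

  fundamental-circuit : ∀ {J e} → Indep M J → Dependent M (J ∪ ⁅ e ⁆) →
    ∃ λ C → IsCircuit M C × C ⊆ J ∪ ⁅ e ⁆ × e ∈ C
  fundamental-circuit {J} {e} J-indep J+e-dep with circuit-⊆ J+e-dep
  ... | C , C-circuit , C⊆J+e with e ∈? C
  ...   | yes e∈C = C , C-circuit , C⊆J+e , e∈C
  ...   | no e∉C  = ⊥-elim (proj₁ C-circuit (indep-⊆ M C⊆J J-indep))
    where
    C⊆J : C ⊆ J
    C⊆J x∈C with ∈-∪⁅⁆⁻ (C⊆J+e x∈C)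
    ... | inj₁ x∈J = x∈J
    ... | inj₂ refl = ⊥-elim (e∉C x∈C)

  spanned-circuit : ∀ {A e} → e ∉ A → Spans A e → ∃ λ C → IsCircuit M C × C ⊆ A ∪ ⁅ e ⁆ × e ∈ C
  spanned-circuit {A} {e} e∉A spans =
    let J , J-basis = basis A
        J⊆A , J-indep , _ = J-basis
        C , C-circuit , C⊆J+e , e∈C =
          fundamental-circuit J-indep (basis-spans⇒dependent J-basis spans (e∉A ∘ J⊆A))
    in C , C-circuit , ∪-monoˡ-⊆ ⁅ e ⁆ J⊆A ∘ C⊆J+e , e∈C

  spans-mono : ∀ {A B e} → A ⊆ B → Spans A e → Spans B e
  spans-mono {A} {B} {e} A⊆B spans with e ∈? A
  ... | yes e∈A = r-mono (x∈p⇒p∪⁅x⁆⊆p (A⊆B e∈A))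
  ... | no e∉A  =
    let C , C-circuit , C⊆A+e , e∈C = spanned-circuit e∉A spans in
    circuit-spans C-circuit e∈C (A⊆B ∘ p⊆q∪⁅x⁆⇒p-x⊆q C⊆A+e)

  circuit-elim : ∀ {C₁ C₂ e f} → IsCircuit M C₁ → IsCircuit M C₂ → e ∈ C₁ → e ∈ C₂ → f ∈ C₁ → f ∉ C₂ →
    ∃ λ C → IsCircuit M C × C ⊆ C₁ ∪ C₂ × e ∉ C × f ∈ C
  circuit-elim {C₁} {C₂} {e} {f} C₁-circuit C₂-circuit e∈C₁ e∈C₂ f∈C₁ f∉C₂ =
    let C , C-circuit , C⊆B+f , f∈C = spanned-circuit f∉B B-spans-f in
    C , C-circuit , B+f⊆C₁∪C₂ ∘ C⊆B+f , e∉C⊆B+f C⊆B+f , f∈C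
    where
    B : Subset n
    B = C₁ ∪ C₂ - e - f
    B⊆C₁∪C₂ : B ⊆ C₁ ∪ C₂
    B⊆C₁∪C₂ = p─q⊆p (C₁ ∪ C₂) ⁅ e ⁆ ∘ p─q⊆p (C₁ ∪ C₂ - e) ⁅ f ⁆
    f∉B : f ∉ B
    f∉B f∈B = x∈p-y⇒x≢y f∈B refl
    C₂-e⊆B : C₂ - e ⊆ B
    C₂-e⊆B x∈C₂-e =
      let x∈C₂ = p─q⊆p C₂ ⁅ e ⁆ x∈C₂-e in
      x∈p∧x≢y⇒x∈p-y (x∈p∧x≢y⇒x∈p-y (q⊆p∪q C₁ C₂ x∈C₂) (x∈p-y⇒x≢y x∈C₂-e)) λ { refl → f∉C₂ x∈C₂ }
    C₁-f⊆B+e : C₁ - f ⊆ B ∪ ⁅ e ⁆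
    C₁-f⊆B+e {x} x∈C₁-f with x ≟ e
    ... | yes refl = q⊆p∪q B ⁅ e ⁆ (x∈⁅x⁆ e)
    ... | no x≢e   = p⊆p∪q ⁅ e ⁆ (x∈p∧x≢y⇒x∈p-y
                       (x∈p∧x≢y⇒x∈p-y (p⊆p∪q C₂ (p─q⊆p C₁ ⁅ f ⁆ x∈C₁-f)) x≢e) (x∈p-y⇒x≢y x∈C₁-f))
    B-spans-f : Spans B f
    B-spans-f = begin
      r (B ∪ ⁅ f ⁆)             ≤⟨ r-mono (∪-monoˡ-⊆ ⁅ f ⁆ (p⊆p∪q ⁅ e ⁆)) ⟩
      r ((B ∪ ⁅ e ⁆) ∪ ⁅ f ⁆)   ≤⟨ circuit-spans C₁-circuit f∈C₁ C₁-f⊆B+e ⟩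
      r (B ∪ ⁅ e ⁆)             ≤⟨ circuit-spans C₂-circuit e∈C₂ C₂-e⊆B ⟩
      r B                       ∎
      where open ≤-Reasoning
    B+f⊆C₁∪C₂ : B ∪ ⁅ f ⁆ ⊆ C₁ ∪ C₂
    B+f⊆C₁∪C₂ = ∪-lub B⊆C₁∪C₂ (x∈p⇒⁅x⁆⊆p (p⊆p∪q C₂ f∈C₁))
    e∉C⊆B+f : ∀ {C} → C ⊆ B ∪ ⁅ f ⁆ → e ∉ C
    e∉C⊆B+f C⊆B+f e∈C with ∈-∪⁅⁆⁻ (C⊆B+f e∈C)
    ... | inj₁ e∈B = x∈p-y⇒x≢y (p─q⊆p (C₁ ∪ C₂ - e) ⁅ f ⁆ e∈B) refl
    ... | inj₂ refl = f∉C₂ e∈C₂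

  Linked : Subset n → Fin n → Fin n → Set
  Linked U x y = ∃ λ C → IsCircuit M C × C ⊆ U × x ∈ C × y ∈ C

  private
    circuit-elim-shrink : ∀ {C₁ C₂ C₃ w z} → IsCircuit M C₂ → IsCircuit M C₃ → C₃ ⊆ C₁ ∪ C₂ →
      w ∈ C₃ → w ∉ C₁ → z ∈ C₂ → z ∉ C₃ →
      ∃ λ C₄ → IsCircuit M C₄ × C₄ ─ C₁ ⊂ C₂ ─ C₁ × C₄ ⊆ C₁ ∪ C₂ × (∃ λ v → v ∈ C₁ × v ∈ C₄) × z ∈ C₄
    circuit-elim-shrink {C₁} {C₂} {C₃} {w} C₂-circuit C₃-circuit C₃⊆C₁∪C₂ w∈C₃ w∉C₁ z∈C₂ z∉C₃ =
      let C₄ , C₄-circuit , C₄⊆C₂∪C₃ , w∉C₄ , z∈C₄ = circuit-elim C₂-circuit C₃-circuit w∈C₂ w∈C₃ z∈C₂ z∉C₃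
          C₄⊆C₁∪C₂ : C₄ ⊆ C₁ ∪ C₂
          C₄⊆C₁∪C₂ = ∪-lub (q⊆p∪q C₁ C₂) C₃⊆C₁∪C₂ ∘ C₄⊆C₂∪C₃
          v , v∈C₄ , v∉C₂ = p⊈q⇒∃x∈p∉q (λ C₄⊆C₂ →
            circuits-incomparable C₂-circuit C₄-circuit (C₄⊆C₂ , w , w∈C₂ , w∉C₄))
      in C₄ , C₄-circuit , (C₄─C₁⊆C₂─C₁ C₄⊆C₁∪C₂ , w , x∈p∧x∉q⇒x∈p─q w∈C₂ w∉C₁ , w∉C₄ ∘ p─q⊆p C₄ C₁) ,
         C₄⊆C₁∪C₂ , (v , x∈p∪q∧x∉q⇒x∈p (C₄⊆C₁∪C₂ v∈C₄) v∉C₂ , v∈C₄) , z∈C₄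
      where
      w∈C₂ : w ∈ C₂
      w∈C₂ = x∈p∪q∧x∉p⇒x∈q (C₃⊆C₁∪C₂ w∈C₃) w∉C₁
      C₄─C₁⊆C₂─C₁ : ∀ {C₄} → C₄ ⊆ C₁ ∪ C₂ → C₄ ─ C₁ ⊆ C₂ ─ C₁
      C₄─C₁⊆C₂─C₁ {C₄} C₄⊆C₁∪C₂ u∈ =
        x∈p∧x∉q⇒x∈p─q (x∈p∪q∧x∉p⇒x∈q (C₄⊆C₁∪C₂ (p─q⊆p C₄ C₁ u∈)) (x∈p─q⇒x∉q u∈)) (x∈p─q⇒x∉q u∈)

  -- Oxley, Prop. 4.1.2: after two circuit eliminations either x and z share a circuit or C₂ can be
  -- replaced by a circuit with fewer elements outside C₁.
  circuit-connects : ∀ {C₁ C₂ x y z} → IsCircuit M C₁ → IsCircuit M C₂ →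
    x ∈ C₁ → y ∈ C₁ → y ∈ C₂ → z ∈ C₂ → Linked (C₁ ∪ C₂) x z
  circuit-connects {C₁} {C₂} {x} C₁-circuit C₂-circuit x∈C₁ = go (⊂-wellFounded (C₂ ─ C₁)) C₂-circuit
    where
    go : ∀ {C₂ y z} → Acc _⊂_ (C₂ ─ C₁) → IsCircuit M C₂ → y ∈ C₁ → y ∈ C₂ → z ∈ C₂ → Linked (C₁ ∪ C₂) x z
    go {C₂} {y} {z} (acc rs) C₂-circuit y∈C₁ y∈C₂ z∈C₂ with x ∈? C₂
    ... | yes x∈C₂ = C₂ , C₂-circuit , q⊆p∪q C₁ C₂ , x∈C₂ , z∈C₂
    ... | no x∉C₂  = via (circuit-elim C₁-circuit C₂-circuit y∈C₁ y∈C₂ x∈C₁ x∉C₂)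
      where
      via : (∃ λ C₃ → IsCircuit M C₃ × C₃ ⊆ C₁ ∪ C₂ × y ∉ C₃ × x ∈ C₃) → Linked (C₁ ∪ C₂) x z
      via (C₃ , C₃-circuit , C₃⊆C₁∪C₂ , y∉C₃ , x∈C₃) with z ∈? C₃
      ... | yes z∈C₃ = C₃ , C₃-circuit , C₃⊆C₁∪C₂ , x∈C₃ , z∈C₃
      ... | no z∉C₃  =
        let w , w∈C₃ , w∉C₁ = p⊈q⇒∃x∈p∉q (λ C₃⊆C₁ →
              circuits-incomparable C₁-circuit C₃-circuit (C₃⊆C₁ , y , y∈C₁ , y∉C₃))
            C₄ , C₄-circuit , C₄─C₁⊂C₂─C₁ , C₄⊆C₁∪C₂ , (v , v∈C₁ , v∈C₄) , z∈C₄ =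
              circuit-elim-shrink C₂-circuit C₃-circuit C₃⊆C₁∪C₂ w∈C₃ w∉C₁ z∈C₂ z∉C₃
            C , C-circuit , C⊆C₁∪C₄ , x∈C , z∈C = go (rs C₄─C₁⊂C₂─C₁) C₄-circuit v∈C₁ v∈C₄ z∈C₄
        in C , C-circuit , ∪-lub (p⊆p∪q C₂) C₄⊆C₁∪C₂ ∘ C⊆C₁∪C₄ , x∈C , z∈C

module Closure {n : ℕ} (M : Matroid n) where
  open Rank M

  IsFlatʳ : Subset n → Set
  IsFlatʳ F = ∀ {e} → Spans F e → e ∈ F

  IsFlatʳ⇒IsFlat : ∀ {F} → IsFlatʳ F → IsFlat M F
  IsFlatʳ⇒IsFlat {F} F-flat e e∈clF = F-flat (≤-reflexive (sym (IsRank⇒≡r (e∈clF (r F) (IsRank-r F)))))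

  spans? : ∀ A e → Dec (Spans A e)
  spans? A e = r (A ∪ ⁅ e ⁆) ≤? r A

  cl : Subset n → Subset n
  cl A = subsetOf (spans? A)

  ⊆-cl : ∀ {A} → A ⊆ cl A
  ⊆-cl e∈A = ∈-subsetOf⁺ (spans? _) (r-mono (x∈p⇒p∪⁅x⁆⊆p e∈A))

  r-cl : ∀ A → r (cl A) ≤ r A
  r-cl A = let J , J⊆A , J-indep , _ = basis A in
    r≤∣basis∣ (⊆-cl ∘ J⊆A , J-indep ,
               λ e∈clA → basis-spans⇒dependent (proj₂ (basis A)) (∈-subsetOf⁻ (spans? A) e∈clA))

  cl-flat : ∀ {A} → IsFlatʳ (cl A)
  cl-flat {A} {e} spans = ∈-subsetOf⁺ (spans? A) (begin
    r (A ∪ ⁅ e ⁆)      ≤⟨ r-mono (∪-monoˡ-⊆ ⁅ e ⁆ ⊆-cl) ⟩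
    r (cl A ∪ ⁅ e ⁆)   ≤⟨ spans ⟩
    r (cl A)           ≤⟨ r-cl A ⟩
    r A                ∎)
    where open ≤-Reasoning

module Nullity {n : ℕ} (M : Matroid n) where
  open Rank M
  open Circuits M

  nullity : Subset n → ℕ
  nullity A = ∣ A ∣ ∸ r A

  r+nullity≡∣∣ : ∀ A → r A + nullity A ≡ ∣ A ∣
  r+nullity≡∣∣ A = m+[n∸m]≡n (r≤∣∣ A)

  dependent⇒0<nullity : ∀ {D} → Dependent M D → 0 < nullity D
  dependent⇒0<nullity D-dep = m<n⇒0<n∸m (≰⇒> (D-dep ∘ ∣I∣≤r⇒indep))

  nullity≤∣A─I∣ : ∀ {A I} → I ⊆ A → Indep M I → nullity A ≤ ∣ A ─ I ∣
  nullity≤∣A─I∣ {A} {I} I⊆A I-indep = begin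
    ∣ A ∣ ∸ r A               ≤⟨ ∸-monoʳ-≤ ∣ A ∣ (∣I∣≤r I⊆A I-indep) ⟩
    ∣ A ∣ ∸ ∣ I ∣             ≡⟨ cong (_∸ ∣ I ∣) (∣q∣+∣p─q∣≡∣p∣ I⊆A) ⟨
    ∣ I ∣ + ∣ A ─ I ∣ ∸ ∣ I ∣ ≡⟨ m+n∸m≡n ∣ I ∣ ∣ A ─ I ∣ ⟩
    ∣ A ─ I ∣                 ∎
    where open ≤-Reasoning

  nullity-mono : ∀ {U B} → U ⊆ B → nullity U ≤ nullity B
  nullity-mono {U} {B} U⊆B = let J , J⊆B , J-indep , _ = basis B in begin
    nullity U             ≤⟨ nullity≤∣A─I∣ (p∩q⊆q J U) (indep-⊆ M (p∩q⊆p J U) J-indep) ⟩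
    ∣ U ─ (J ∩ U) ∣       ≤⟨ p⊆q⇒∣p∣≤∣q∣ (λ x∈ → let x∈U = p─q⊆p U (J ∩ U) x∈ in
                              x∈p∧x∉q⇒x∈p─q (U⊆B x∈U) λ x∈J → x∈p─q⇒x∉q x∈ (x∈p∩q⁺ (x∈J , x∈U))) ⟩
    ∣ B ─ J ∣             ≡⟨ m+n∸m≡n ∣ J ∣ ∣ B ─ J ∣ ⟨
    ∣ J ∣ + ∣ B ─ J ∣ ∸ ∣ J ∣ ≡⟨ cong (_∸ ∣ J ∣) (∣q∣+∣p─q∣≡∣p∣ J⊆B) ⟩
    nullity B             ∎
    where open ≤-Reasoning

  nullity-spans : ∀ {B e} → e ∉ B → Spans B e → suc (nullity B) ≤ nullity (B ∪ ⁅ e ⁆)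
  nullity-spans {B} {e} e∉B spans = begin
    suc (∣ B ∣ ∸ r B)          ≡⟨ +-∸-assoc 1 (r≤∣∣ B) ⟨
    suc ∣ B ∣ ∸ r B            ≡⟨ cong (_∸ r B) (∣p∪⁅x⁆∣≡1+∣p∣ e∉B) ⟨
    ∣ B ∪ ⁅ e ⁆ ∣ ∸ r B        ≤⟨ ∸-monoʳ-≤ ∣ B ∪ ⁅ e ⁆ ∣ spans ⟩
    nullity (B ∪ ⁅ e ⁆)        ∎
    where open ≤-Reasoning

  nullity-∪-circuit : ∀ {U X} → IsCircuit M X → X ⊈ U → suc (nullity U) ≤ nullity (U ∪ X)
  nullity-∪-circuit {U} {X} X-circuit X⊈U with p⊈q⇒∃x∈p∉q X⊈U
  ... | e , e∈X , e∉U = begin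
    suc (nullity U)       ≤⟨ s≤s (nullity-mono U⊆B) ⟩
    suc (nullity B)       ≤⟨ nullity-spans (λ e∈B → x∈p-y⇒x≢y e∈B refl) B-spans-e ⟩
    nullity (B ∪ ⁅ e ⁆)   ≤⟨ nullity-mono B+e⊆U∪X ⟩
    nullity (U ∪ X)       ∎
    where
    open ≤-Reasoning
    B : Subset n
    B = U ∪ X - e
    U⊆B : U ⊆ B
    U⊆B x∈U = x∈p∧x≢y⇒x∈p-y (p⊆p∪q X x∈U) λ { refl → e∉U x∈U }
    B-spans-e : Spans B e
    B-spans-e = circuit-spans X-circuit e∈X λ x∈ →
      x∈p∧x≢y⇒x∈p-y (q⊆p∪q U X (p─q⊆p X ⁅ e ⁆ x∈)) (x∈p-y⇒x≢y x∈)
    B+e⊆U∪X : B ∪ ⁅ e ⁆ ⊆ U ∪ X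
    B+e⊆U∪X = ∪-lub (p─q⊆p (U ∪ X) ⁅ e ⁆) (x∈p⇒⁅x⁆⊆p (q⊆p∪q U X e∈X))

module _ {n : ℕ} where

  ⋃-++ : (Xs Ys : List (Subset n)) → ⋃ (Xs ++ Ys) ≡ ⋃ Xs ∪ ⋃ Ys
  ⋃-++ []       Ys = sym (∪-identityˡ (⋃ Ys))
  ⋃-++ (X ∷ Xs) Ys = trans (cong (X ∪_) (⋃-++ Xs Ys)) (sym (∪-assoc X (⋃ Xs) (⋃ Ys)))

  ProperFrom-++ : ∀ {U : Subset n} Xs {Ys : List (Subset n)} →
    ProperFrom U Xs → ProperFrom (U ∪ ⋃ Xs) Ys → ProperFrom U (Xs ++ Ys)
  ProperFrom-++ {U} [] {Ys} _ proper = subst (λ V → ProperFrom V Ys) (∪-identityʳ U) proper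
  ProperFrom-++ {U} (X ∷ Xs) {Ys} (X⊈U , Xs-proper) proper =
    X⊈U , ProperFrom-++ Xs Xs-proper (subst (λ V → ProperFrom V Ys) (sym (∪-assoc U X (⋃ Xs))) proper)

  ProperFrom-∪ˡ : ∀ {W V : Subset n} Ys → Disjoint W (⋃ Ys) → ProperFrom V Ys → ProperFrom (W ∪ V) Ys
  ProperFrom-∪ˡ []       _    _ = _
  ProperFrom-∪ˡ {W} {V} (Y ∷ Ys) W#Ys (Y⊈V , Ys-proper) =
    (λ Y⊆W∪V → Y⊈V λ y∈Y → x∈p∪q∧x∉p⇒x∈q (Y⊆W∪V y∈Y) λ y∈W → W#Ys y∈W (p⊆p∪q (⋃ Ys) y∈Y)) ,
    subst (λ T → ProperFrom T Ys) (sym (∪-assoc W V Y))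
      (ProperFrom-∪ˡ Ys (λ x∈W → W#Ys x∈W ∘ q⊆p∪q Y (⋃ Ys)) Ys-proper)

  module _ {𝒳 : Family n} (𝒳-nonempty : ∀ {X} → 𝒳 X → Nonempty X) where

    IsProperSeq⇒ProperFrom : ∀ {W} Ys → Disjoint W (⋃ Ys) → IsProperSeq 𝒳 Ys → ProperFrom W Ys
    IsProperSeq⇒ProperFrom []       _    _ = _
    IsProperSeq⇒ProperFrom (Y ∷ Ys) W#Ys (Y∈𝒳 ∷ _ , Ys-proper) =
      (λ Y⊆W → let y , y∈Y = 𝒳-nonempty Y∈𝒳 in W#Ys (Y⊆W y∈Y) (p⊆p∪q (⋃ Ys) y∈Y)) ,
      ProperFrom-∪ˡ Ys (λ x∈W → W#Ys x∈W ∘ q⊆p∪q Y (⋃ Ys)) Ys-proper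

    IsProperSeq-++ : ∀ Xs {Ys} → Disjoint (⋃ Xs) (⋃ Ys) → IsProperSeq 𝒳 Xs → IsProperSeq 𝒳 Ys →
      IsProperSeq 𝒳 (Xs ++ Ys)
    IsProperSeq-++ []       _     _                      Ys-proper = Ys-proper
    IsProperSeq-++ (X ∷ Xs) {Ys} Xs#Ys (Xs∈𝒳 , Xs-proper) (Ys∈𝒳 , Ys-proper) =
      ++⁺ Xs∈𝒳 Ys∈𝒳 , ProperFrom-++ Xs Xs-proper (IsProperSeq⇒ProperFrom Ys Xs#Ys (Ys∈𝒳 , Ys-proper))

val≡+∣∪⋃∣∸length : ∀ {n} (F : Subset n) S → length S ≤ ∣ F ∪ ⋃ S ∣ → val F S ≡ ℤ.+ (∣ F ∪ ⋃ S ∣ ∸ length S)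
val≡+∣∪⋃∣∸length F S length≤ = trans (ℤ.m-n≡m⊖n ∣ F ∪ ⋃ S ∣ (length S)) (ℤ.⊖-≥ length≤)

module ProperSequences {n : ℕ} {𝒳 : Family n} (N : Matroid n) (isX : IsXMatroid 𝒳 N) where
  open Rank N
  open Nullity N

  nullity-ProperFrom : ∀ {U} Xs → All 𝒳 Xs → ProperFrom U Xs → nullity U + length Xs ≤ nullity (U ∪ ⋃ Xs)
  nullity-ProperFrom {U} [] _ _ = ≤-reflexive (trans (+-identityʳ _) (cong nullity (sym (∪-identityʳ U))))
  nullity-ProperFrom {U} (X ∷ Xs) (X∈𝒳 ∷ Xs∈𝒳) (X⊈U , Xs-proper) = begin
    nullity U + suc (length Xs)     ≡⟨ +-suc (nullity U) (length Xs) ⟩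
    suc (nullity U) + length Xs     ≤⟨ +-monoˡ-≤ (length Xs) (nullity-∪-circuit (isX X X∈𝒳) X⊈U) ⟩
    nullity (U ∪ X) + length Xs     ≤⟨ nullity-ProperFrom Xs Xs∈𝒳 Xs-proper ⟩
    nullity ((U ∪ X) ∪ ⋃ Xs)        ≡⟨ cong nullity (∪-assoc U X (⋃ Xs)) ⟩
    nullity (U ∪ X ∪ ⋃ Xs)          ∎
    where open ≤-Reasoning

  length≤nullity : ∀ {S} → IsProperSeq 𝒳 S → length S ≤ nullity (⋃ S)
  length≤nullity {[]}     _ = z≤n
  length≤nullity {X ∷ Xs} (X∈𝒳 ∷ Xs∈𝒳 , Xs-proper) = begin
    suc (length Xs)               ≤⟨ +-monoˡ-≤ (length Xs) (dependent⇒0<nullity (proj₁ (isX X X∈𝒳))) ⟩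
    nullity X + length Xs         ≤⟨ nullity-ProperFrom Xs Xs∈𝒳 Xs-proper ⟩
    nullity (X ∪ ⋃ Xs)            ∎
    where open ≤-Reasoning

  r∪⋃+length≤∣∪⋃∣ : ∀ {S} → IsProperSeq 𝒳 S → ∀ G → r (G ∪ ⋃ S) + length S ≤ ∣ G ∪ ⋃ S ∣
  r∪⋃+length≤∣∪⋃∣ {S} S-proper G = begin
    r (G ∪ ⋃ S) + length S              ≤⟨ +-monoʳ-≤ (r (G ∪ ⋃ S))
                                             (≤-trans (length≤nullity S-proper) (nullity-mono (q⊆p∪q G (⋃ S)))) ⟩
    r (G ∪ ⋃ S) + nullity (G ∪ ⋃ S)     ≡⟨ r+nullity≡∣∣ (G ∪ ⋃ S) ⟩
    ∣ G ∪ ⋃ S ∣                         ∎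
    where open ≤-Reasoning

  r+length≤∣∪⋃∣ : ∀ {S} → IsProperSeq 𝒳 S → ∀ F → r F + length S ≤ ∣ F ∪ ⋃ S ∣
  r+length≤∣∪⋃∣ {S} S-proper F =
    ≤-trans (+-monoˡ-≤ (length S) (r-mono (p⊆p∪q {p = F} (⋃ S)))) (r∪⋃+length≤∣∪⋃∣ S-proper F)

  proper⇒val≡+∣∪⋃∣∸length : ∀ {S} → IsProperSeq 𝒳 S → ∀ F → val F S ≡ ℤ.+ (∣ F ∪ ⋃ S ∣ ∸ length S)
  proper⇒val≡+∣∪⋃∣∸length {S} S-proper F =
    val≡+∣∪⋃∣∸length F S (m+n≤o⇒n≤o (r F) (r+length≤∣∪⋃∣ S-proper F))

  +r≤val : ∀ {S} → IsProperSeq 𝒳 S → ∀ F → ℤ.+ r F ℤ.≤ val F S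
  +r≤val {S} S-proper F = subst (ℤ.+ r F ℤ.≤_) (sym (proper⇒val≡+∣∪⋃∣∸length S-proper F))
    (ℤ.+≤+ (m+n≤o⇒m≤o∸n (r F) (r+length≤∣∪⋃∣ S-proper F)))

  ∣∪⋃∣≤r+length⇒val≡+r : ∀ {S} → IsProperSeq 𝒳 S → ∀ F → ∣ F ∪ ⋃ S ∣ ≤ r F + length S → val F S ≡ ℤ.+ r F
  ∣∪⋃∣≤r+length⇒val≡+r {S} S-proper F ∣F∪⋃S∣≤ = begin
    val F S                                  ≡⟨ proper⇒val≡+∣∪⋃∣∸length S-proper F ⟩
    ℤ.+ (∣ F ∪ ⋃ S ∣ ∸ length S)             ≡⟨ cong (λ m → ℤ.+ (m ∸ length S))
                                                  (≤-antisym ∣F∪⋃S∣≤ (r+length≤∣∪⋃∣ S-proper F)) ⟩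
    ℤ.+ (r F + length S ∸ length S)          ≡⟨ cong ℤ.+_ (m+n∸n≡m (r F) (length S)) ⟩
    ℤ.+ r F                                  ∎
    where open ≡-Reasoning

  val≡+r⇒∣∪⋃∣≡r+length : ∀ {S} → IsProperSeq 𝒳 S → ∀ F → val F S ≡ ℤ.+ r F → ∣ F ∪ ⋃ S ∣ ≡ r F + length S
  val≡+r⇒∣∪⋃∣≡r+length {S} S-proper F val≡r = begin
    ∣ F ∪ ⋃ S ∣                          ≡⟨ m∸n+n≡m (m+n≤o⇒n≤o (r F) (r+length≤∣∪⋃∣ S-proper F)) ⟨
    ∣ F ∪ ⋃ S ∣ ∸ length S + length S    ≡⟨ cong (_+ length S)
                                              (ℤ.+-injective (trans (sym (proper⇒val≡+∣∪⋃∣∸length S-proper F)) val≡r)) ⟩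
    r F + length S                       ∎
    where open ≡-Reasoning

module Separators {n : ℕ} (M : Matroid n) where
  open Rank M
  open Circuits M
  open Closure M

  -- K is a union of connected components of the restriction of M to F.
  IsSeparator : Subset n → Subset n → Set
  IsSeparator F K = K ⊆ F × (∀ {D w} → IsCircuit M D → D ⊆ F → w ∈ D → w ∈ K → D ⊆ K)

  private
    loopless-spanned-circuit : Loopless M → ∀ {A e} → e ∉ A → Spans A e →
      ∃ λ C → IsCircuit M C × C ⊆ A ∪ ⁅ e ⁆ × e ∈ C × ∃ λ w → w ∈ C × w ∈ A
    loopless-spanned-circuit loopless {A} {e} e∉A spans with spanned-circuit e∉A spans
    ... | C , C-circuit , C⊆A+e , e∈C
      with p⊈q⇒∃x∈p∉q (λ C⊆⁅e⁆ → proj₁ C-circuit (indep-⊆ M C⊆⁅e⁆ (loopless e)))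
    ... | w , w∈C , w∉⁅e⁆ = C , C-circuit , C⊆A+e , e∈C , w , w∈C , w∈A
      where
      w∈A : w ∈ A
      w∈A = x∈p∪q∧x∉q⇒x∈p (C⊆A+e w∈C) w∉⁅e⁆

  separator-flat : Loopless M → ∀ {F K} → IsFlatʳ F → IsSeparator F K → IsFlatʳ K
  separator-flat loopless {F} {K} F-flat (K⊆F , K-closed) {e} spans with e ∈? K
  ... | yes e∈K = e∈K
  ... | no e∉K =
    let C , C-circuit , C⊆K+e , e∈C , w , w∈C , w∈K = loopless-spanned-circuit loopless e∉K spans in
    K-closed C-circuit (∪-lub K⊆F (x∈p⇒⁅x⁆⊆p (F-flat (spans-mono K⊆F spans))) ∘ C⊆K+e) w∈C w∈K e∈C

  separator-complement-flat : Loopless M → ∀ {F K} → IsFlatʳ F → IsSeparator F K → IsFlatʳ (F ─ K)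
  separator-complement-flat loopless {F} {K} F-flat (K⊆F , K-closed) {e} spans with e ∈? F ─ K
  ... | yes e∈F─K = e∈F─K
  ... | no e∉F─K =
    let C , C-circuit , C⊆G+e , e∈C , w , w∈C , w∈F─K = loopless-spanned-circuit loopless e∉F─K spans
        e∈F = F-flat (spans-mono (p─q⊆p F K) spans)
        e∈K = e∈F⇒e∈K e∈F
    in ⊥-elim (x∈p─q⇒x∉q w∈F─K (K-closed C-circuit (∪-lub (p─q⊆p F K) (x∈p⇒⁅x⁆⊆p e∈F) ∘ C⊆G+e) e∈C e∈K w∈C))
    where
    e∈F⇒e∈K : e ∈ F → e ∈ K
    e∈F⇒e∈K e∈F with e ∈? K
    ... | yes e∈K = e∈K
    ... | no e∉K = ⊥-elim (e∉F─K (x∈p∧x∉q⇒x∈p─q e∈F e∉K))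

  separator-indep-∪ : ∀ {F K I₁ I₂} → IsSeparator F K → I₁ ⊆ K → I₂ ⊆ F ─ K →
    Indep M I₁ → Indep M I₂ → Indep M (I₁ ∪ I₂)
  separator-indep-∪ {F} {K} {I₁} {I₂} (K⊆F , K-closed) I₁⊆K I₂⊆F─K I₁-indep I₂-indep
    with indep? M (I₁ ∪ I₂)
  ... | yes indep = indep
  ... | no dep with circuit-⊆ dep
  ... | C , C-circuit , C⊆I₁∪I₂ with any? (λ d → (d ∈? C) ×-dec (d ∈? I₁))
  ...   | yes (d , d∈C , d∈I₁) = ⊥-elim (proj₁ C-circuit (indep-⊆ M C⊆I₁ I₁-indep))
    where
    C⊆K : C ⊆ K
    C⊆K = K-closed C-circuit (∪-lub (K⊆F ∘ I₁⊆K) (p─q⊆p F K ∘ I₂⊆F─K) ∘ C⊆I₁∪I₂)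
                  d∈C (I₁⊆K d∈I₁)
    C⊆I₁ : C ⊆ I₁
    C⊆I₁ x∈C = [ id , (λ x∈I₂ → ⊥-elim (x∈p─q⇒x∉q (I₂⊆F─K x∈I₂) (C⊆K x∈C))) ] (x∈p∪q⁻ I₁ I₂ (C⊆I₁∪I₂ x∈C))
  ...   | no C∩I₁-empty = ⊥-elim (proj₁ C-circuit (indep-⊆ M C⊆I₂ I₂-indep))
    where
    C⊆I₂ : C ⊆ I₂
    C⊆I₂ x∈C = [ (λ x∈I₁ → ⊥-elim (C∩I₁-empty (_ , x∈C , x∈I₁))) , id ] (x∈p∪q⁻ I₁ I₂ (C⊆I₁∪I₂ x∈C))

  separator-r-+ : ∀ {F K} → IsSeparator F K → r K + r (F ─ K) ≤ r F
  separator-r-+ {F} {K} K-separator@(K⊆F , _) =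
    let J₁ , J₁⊆K , J₁-indep , _ = basis K
        J₂ , J₂⊆F─K , J₂-indep , _ = basis (F ─ K)
    in begin
      ∣ J₁ ∣ + ∣ J₂ ∣    ≡⟨ ∣p∪q∣≡∣p∣+∣q∣ (λ x∈J₁ x∈J₂ → x∈p─q⇒x∉q (J₂⊆F─K x∈J₂) (J₁⊆K x∈J₁)) ⟨
      ∣ J₁ ∪ J₂ ∣        ≤⟨ ∣I∣≤r (∪-lub (K⊆F ∘ J₁⊆K) (p─q⊆p F K ∘ J₂⊆F─K))
                              (separator-indep-∪ K-separator J₁⊆K J₂⊆F─K J₁-indep J₂-indep) ⟩
      r F                ∎
    where open ≤-Reasoning

  linked? : ∀ F x y → Dec (Linked F x y)
  linked? F x y = anySubset? (λ C → isCircuit? C ×-dec C ⊆? F ×-dec x ∈? C ×-dec y ∈? C)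

  linked-sym : ∀ {F x y} → Linked F x y → Linked F y x
  linked-sym (C , C-circuit , C⊆F , x∈C , y∈C) = C , C-circuit , C⊆F , y∈C , x∈C

  linked-trans : ∀ {F x y z} → Linked F x y → Linked F y z → Linked F x z
  linked-trans (C₁ , C₁-circuit , C₁⊆F , x∈C₁ , y∈C₁) (C₂ , C₂-circuit , C₂⊆F , y∈C₂ , z∈C₂) =
    let C , C-circuit , C⊆C₁∪C₂ , x∈C , z∈C = circuit-connects C₁-circuit C₂-circuit x∈C₁ y∈C₁ y∈C₂ z∈C₂ in
    C , C-circuit , ∪-lub C₁⊆F C₂⊆F ∘ C⊆C₁∪C₂ , x∈C , z∈C

  component : Subset n → Fin n → Subset n
  component F c = subsetOf (linked? F c)

  component-separator : ∀ F c → IsSeparator F (component F c)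
  component-separator F c = K⊆F , K-closed
    where
    K⊆F : component F c ⊆ F
    K⊆F x∈K = let C , _ , C⊆F , _ , x∈C = ∈-subsetOf⁻ (linked? F c) x∈K in C⊆F x∈C
    K-closed : ∀ {D w} → IsCircuit M D → D ⊆ F → w ∈ D → w ∈ component F c → D ⊆ component F c
    K-closed D-circuit D⊆F w∈D w∈K x∈D =
      ∈-subsetOf⁺ (linked? F c) (linked-trans (∈-subsetOf⁻ (linked? F c) w∈K) (_ , D-circuit , D⊆F , w∈D , x∈D))

  component-connected : ∀ F c → IsConnected M (component F c)
  component-connected F c e f e∈K f∈K =
    let C , C-circuit , C⊆F , e∈C , f∈C =
          linked-trans (linked-sym (∈-subsetOf⁻ (linked? F c) e∈K)) (∈-subsetOf⁻ (linked? F c) f∈K) in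
    C , C-circuit , proj₂ (component-separator F c) C-circuit C⊆F e∈C e∈K , e∈C , f∈C

module TightSequences {n : ℕ} {𝒳 : Family n} {M : Matroid n} (isX : IsXMatroid 𝒳 M) (loopless : Loopless M)
  (hyp : ∀ F → IsFlat M F → IsConnected M F →
    ∃[ S ] (IsProperSeq 𝒳 S × ∃[ k ] (IsRank M F k × val F S ≡ ℤ.+ k))) where
  open Rank M
  open Circuits M
  open Closure M
  open Separators M
  open ProperSequences M isX

  -- Together with r∪⋃+length≤∣∪⋃∣, the last component says val(F, S) = r(F).
  HasTightSequence : Subset n → Set
  HasTightSequence F = ∃ λ S → IsProperSeq 𝒳 S × ⋃ S ⊆ F × ∣ F ∣ ≤ r F + length S

  connected-flat-tight : ∀ {F} → IsFlatʳ F → IsConnected M F → HasTightSequence F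
  connected-flat-tight {F} F-flat F-connected with hyp F (IsFlatʳ⇒IsFlat F-flat) F-connected
  ... | S , S-proper , k , F-rank , val≡k =
    S , S-proper , ⋃S⊆F , ≤-trans (p⊆q⇒∣p∣≤∣q∣ (p⊆p∪q {p = F} (⋃ S))) (≤-reflexive ∣F∪⋃S∣≡rF+∣S∣)
    where
    ∣F∪⋃S∣≡rF+∣S∣ : ∣ F ∪ ⋃ S ∣ ≡ r F + length S
    ∣F∪⋃S∣≡rF+∣S∣ = val≡+r⇒∣∪⋃∣≡r+length S-proper F (subst (λ m → val F S ≡ ℤ.+ m) (IsRank⇒≡r F-rank) val≡k)
    ⋃S⊆F : ⋃ S ⊆ F
    ⋃S⊆F {x} x∈⋃S = F-flat (≤-trans (r-mono F+x⊆F∪⋃S) (+-cancelʳ-≤ (length S) _ _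
      (≤-trans (r∪⋃+length≤∣∪⋃∣ S-proper F) (≤-reflexive ∣F∪⋃S∣≡rF+∣S∣))))
      where
      F+x⊆F∪⋃S : F ∪ ⁅ x ⁆ ⊆ F ∪ ⋃ S
      F+x⊆F∪⋃S = ∪-lub (p⊆p∪q (⋃ S)) (x∈p⇒⁅x⁆⊆p (q⊆p∪q F (⋃ S) x∈⋃S))

  separator-tight : ∀ {F K} → IsSeparator F K → HasTightSequence K → HasTightSequence (F ─ K) → HasTightSequence F
  separator-tight {F} {K} K-separator@(K⊆F , _)
    (S₁ , S₁-proper , ⋃S₁⊆K , K-tight) (S₂ , S₂-proper , ⋃S₂⊆F─K , F─K-tight) =
    S₁ ++ S₂ ,
    IsProperSeq-++ (circuit-nonempty ∘ isX _) S₁ (λ x∈S₁ x∈S₂ → x∈p─q⇒x∉q (⋃S₂⊆F─K x∈S₂) (⋃S₁⊆K x∈S₁))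
      S₁-proper S₂-proper ,
    ∪-lub (K⊆F ∘ ⋃S₁⊆K) (p─q⊆p F K ∘ ⋃S₂⊆F─K) ∘ subst (_ ∈_) (⋃-++ S₁ S₂) ,
    (begin
      ∣ F ∣                                            ≡⟨ ∣q∣+∣p─q∣≡∣p∣ K⊆F ⟨
      ∣ K ∣ + ∣ F ─ K ∣                                ≤⟨ +-mono-≤ K-tight F─K-tight ⟩
      (r K + length S₁) + (r (F ─ K) + length S₂)      ≡⟨ interchange (r K) (length S₁) (r (F ─ K)) (length S₂) ⟩
      (r K + r (F ─ K)) + (length S₁ + length S₂)      ≤⟨ +-monoˡ-≤ _ (separator-r-+ K-separator) ⟩
      r F + (length S₁ + length S₂)                    ≡⟨ cong (r F +_) (length-++ S₁) ⟨
      r F + length (S₁ ++ S₂)                          ∎)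
    where open ≤-Reasoning

  flat-tight : ∀ {F} → Acc _<_ (r F) → IsFlatʳ F → HasTightSequence F
  flat-tight {F} (acc rs) F-flat with indep? M F
  ... | yes F-indep = [] , ([] , _) , ⊥⊆ , ≤-trans (∣I∣≤r id F-indep) (m≤m+n (r F) 0)
  ... | no F-dep with circuit-⊆ F-dep
  ... | C , C-circuit , C⊆F with circuit-nonempty C-circuit
  ... | c , c∈C =
    separator-tight K-separator
      (connected-flat-tight (separator-flat loopless F-flat K-separator) (component-connected F c))
      (flat-tight (rs r[F─K]<r[F]) (separator-complement-flat loopless F-flat K-separator))
    where
    K-separator : IsSeparator F (component F c)
    K-separator = component-separator F c
    c∈K : c ∈ component F c
    c∈K = ∈-subsetOf⁺ (linked? F c) (C , C-circuit , C⊆F , c∈C , c∈C)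
    r[F─K]<r[F] : r (F ─ component F c) < r F
    r[F─K]<r[F] = ≤-trans
      (+-monoˡ-≤ _ (≤-trans (≤-reflexive (sym (∣⁅x⁆∣≡1 c))) (∣I∣≤r (x∈p⇒⁅x⁆⊆p c∈K) (loopless c))))
      (separator-r-+ K-separator)

  tight-sequence : ∀ F → ∃ λ S → IsProperSeq 𝒳 S × ∣ F ∪ ⋃ S ∣ ≤ r F + length S
  tight-sequence F =
    let S , S-proper , ⋃S⊆clF , clF-tight = flat-tight (<-wellFounded (r (cl F))) cl-flat in
    S , S-proper , (begin
      ∣ F ∪ ⋃ S ∣           ≤⟨ p⊆q⇒∣p∣≤∣q∣ (∪-lub ⊆-cl ⋃S⊆clF) ⟩
      ∣ cl F ∣              ≤⟨ clF-tight ⟩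
      r (cl F) + length S   ≤⟨ +-monoˡ-≤ (length S) (r-cl F) ⟩
      r F + length S        ∎)
    where open ≤-Reasoning

  IsValX-r : ∀ F → IsValX 𝒳 F (ℤ.+ r F)
  IsValX-r F =
    let S , S-proper , tight = tight-sequence F in
    (S , S-proper , ∣∪⋃∣≤r+length⇒val≡+r S-proper F tight) , λ S′ S′-proper → +r≤val S′-proper F

  X-matroid-≼ : ∀ M′ → IsXMatroid 𝒳 M′ → M′ ≼ M
  X-matroid-≼ M′ isX′ I I-indep′ =
    let S , S-proper , tight = tight-sequence I in
    ∣I∣≤r⇒indep (+-cancelʳ-≤ (length S) _ _ (begin
      ∣ I ∣ + length S                  ≤⟨ +-monoˡ-≤ (length S) (Rank.∣I∣≤r M′ (p⊆p∪q {p = I} (⋃ S)) I-indep′) ⟩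
      Rank.r M′ (I ∪ ⋃ S) + length S    ≤⟨ ProperSequences.r∪⋃+length≤∣∪⋃∣ M′ isX′ S-proper I ⟩
      ∣ I ∪ ⋃ S ∣                       ≤⟨ tight ⟩
      r I + length S                    ∎))
    where open ≤-Reasoning

open import Data.Integer using (+_)

lemma2p1 : ∀ {n : ℕ} (𝒳 : Family n) (M : Matroid n) →
    IsXMatroid 𝒳 M → Loopless M →
    (∀ F → IsFlat M F → IsConnected M F →
    ∃[ S ] (IsProperSeq 𝒳 S × ∃[ k ] (IsRank M F k × val F S ≡ + k))) →
    (∀ (F : Subset n) (k : ℕ) → IsRank M F k → IsValX 𝒳 F (+ k))
    × (∀ (M′ : Matroid n) → IsXMatroid 𝒳 M′ → M′ ≼ M)
lemma2p1 𝒳 M isX loopless hyp =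
  (λ F k F-rank → subst (IsValX 𝒳 F ∘ +_) (sym (Rank.IsRank⇒≡r M F-rank)) (IsValX-r F)) ,
  X-matroid-≼
  where open TightSequences isX loopless hyp
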